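{- The patterns $102$, $0102$ and $0112$ are Wilf equivalent on ascent sequences: for every $n\ge1$, the numbers of ascent sequences of length $n$ avoiding each of them are equal. In particular, for every $n$, the set of ascent sequences of length $n$ avoiding $102$ equals the set of ascent sequences of length $n$ avoiding $0102$.
   Context: An ascent sequence is a finite sequence $x_1x_2\ldots x_n$ of nonnegative integers with $x_1=0$ and $x_i\le \operatorname{asc}(x_1\ldots x_{i-1})+1$ for all $1<i\le n$, where $\operatorname{asc}(y_1\ldots y_k)$ is the number of indices $j$ with $y_j<y_{j+1}$. A pattern is a finite word over the nonnegative integers. An occurrence of a pattern $p=p_1\ldots p_k$ in $x_1\ldots x_n$ is a subsequence $x_{i_1}\ldots x_{i_k}$, $i_1<\cdots<i_k$, with $x_{i_a}<x_{i_b}$ iff $p_a<p_b$ and $x_{i_a}=x_{i_b}$ iff $p_a=p_b$; a sequence avoids $p$ if it has no occurrence of $p$. Two patterns are Wilf equivalent if for every $n$ the numbers of ascent sequences of length $n$ avoiding them coincide. -}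

module Defs where

open import Data.Nat using (ℕ; zero; suc; _+_; _≤_; _<_; _<ᵇ_)
open import Data.Bool using (if_then_else_)
open import Data.List using (List; []; _∷_; length; lookup; take)
open import Data.List.Membership.Propositional using (_∈_)
open import Data.List.Relation.Unary.Unique.Propositional using (Unique)
open import Data.Fin as Fin using (Fin; toℕ)
open import Data.Product using (Σ; ∃; _×_)
open import Relation.Nullary using (¬_)
open import Relation.Binary.PropositionalEquality using (_≡_)
open import Function.Bundles using (_⇔_)

asc : List ℕ → ℕ
asc (a ∷ b ∷ r) = (if a <ᵇ b then 1 else 0) + asc (b ∷ r)
asc _ = 0

-- x is an ascent sequence: x₁ = 0 (so x is nonempty) and, for every position,
-- x_i ≤ asc(x₁ … x_{i-1}) + 1  (0-based index i: the prefix is take i x;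
-- for i = 0 this is the harmless condition x₁ ≤ 1).
IsAscent : List ℕ → Set
IsAscent x = (∃ λ r → x ≡ 0 ∷ r)
           × ((i : Fin (length x)) → lookup x i ≤ suc (asc (take (toℕ i) x)))

Occurs : List ℕ → List ℕ → Set
Occurs p x =
  Σ (Fin (length p) → Fin (length x)) λ f →
      ((a b : Fin (length p)) → a Fin.< b → f a Fin.< f b)
    × ((a b : Fin (length p)) →
          ((lookup x (f a) < lookup x (f b)) ⇔ (lookup p a < lookup p b))
        × ((lookup x (f a) ≡ lookup x (f b)) ⇔ (lookup p a ≡ lookup p b)))

Avoids : List ℕ → List ℕ → Set
Avoids p x = ¬ Occurs p x

AvAsc : List ℕ → ℕ → List ℕ → Set
AvAsc p n x = IsAscent x × length x ≡ n × Avoids p x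

HasCount : (List ℕ → Set) → ℕ → Set
HasCount P m = Σ (List (List ℕ)) λ L →
  Unique L × ((x : List ℕ) → (x ∈ L) ⇔ P x) × length L ≡ m

p102 p0102 p0112 : List ℕ
p102  = 1 ∷ 0 ∷ 2 ∷ []
p0102 = 0 ∷ 1 ∷ 0 ∷ 2 ∷ []
p0112 = 0 ∷ 1 ∷ 1 ∷ 2 ∷ []

module Submission where

-- Sequences are handled reversed (most recent entry first), so that appending a new
-- last entry is consing onto a list; IsAscentR is the ascent condition in this reading
-- and isAscent-reverse relates it to IsAscent.  Occurrences of the three patterns are
-- characterised by sublists formed by values a < b < c (occurs102⇔ and its siblings),
-- which become mirrored sublists under reversal (avoids-reverse).
--
-- The counting argument uses generating trees.  The module GeneratingTree shows that
-- an invariant attaching labels (k , o) to sequences, preserved by a fixed succession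
-- rule and exhausting the admissible next entries, yields a duplicate-free enumeration
-- whose level sizes depend only on the rule (labelLevel).  The modules Avoiding102 and
-- Avoiding0112 supply such invariants for the same rule, so the two classes have equal
-- counts.  Finally the 102 invariant shows that in a 102-avoiding ascent sequence every
-- "10" extends to "010", so the 0102-avoiders are exactly the 102-avoiders.

open import Defs
open import Data.Nat using (ℕ; zero; suc; _+_; _≤_; _<_; _<ᵇ_; z≤n; s≤s; s≤s⁻¹)
open import Data.Nat.Properties
open import Data.Bool using (Bool; true; false; if_then_else_)
open import Data.List
  using (List; []; _∷_; _∷ʳ_; _++_; length; lookup; take; map; reverse; tabulate; downFrom; concatMap)
open import Data.List.Properties
  using ( ++-assoc; ++-identityʳ; ∷-injectiveˡ; ∷-injectiveʳ; tabulate-cong; map-id; map-∘; map-++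
        ; length-map; unfold-reverse; reverse-involutive; reverse-injective; length-reverse
        ; map-concatMap; concatMap-cong; concatMap-map)
open import Data.List.Membership.Propositional using (_∈_; find; lose)
open import Data.List.Membership.Propositional.Properties
  using (∈-map⁺; ∈-map⁻; ∈-concatMap⁺; ∈-concatMap⁻; ∈-downFrom⁺; ∈-downFrom⁻)
open import Data.List.Relation.Unary.Any using (here; there)
open import Data.List.Relation.Unary.All as All using ()
open import Data.List.Relation.Unary.AllPairs using ([]; _∷_)
open import Data.List.Relation.Unary.Unique.Propositional using (Unique)
import Data.List.Relation.Unary.Unique.Propositional.Properties as Unique
open import Data.List.Relation.Binary.Sublist.Propositional using (_⊆_; []; _∷_; minimum; ⊆-trans)
  renaming (_∷ʳ_ to skip)
open import Data.List.Relation.Binary.Sublist.Propositional.Properties using (reverse⁺; ∷ˡ⁻)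
open import Data.Fin as Fin using (Fin; toℕ; #_)
open import Data.Product using (Σ; ∃; _×_; _,_; proj₁; proj₂)
open import Data.Empty using (⊥; ⊥-elim)
open import Data.Unit using (tt)
open import Data.Sum using (_⊎_; inj₁; inj₂)
open import Relation.Binary using (tri<; tri≈; tri>)
open import Relation.Nullary using (¬_)
open import Relation.Binary.PropositionalEquality
open import Function.Bundles using (_⇔_; mk⇔; Equivalence)
open import Function using (_∘_)
open Equivalence using (to; from)

ascentBit : ℕ → ℕ → ℕ
ascentBit u v = if u <ᵇ v then 1 else 0

ascentsR : List ℕ → ℕ
ascentsR (v ∷ u ∷ r) = ascentsR (u ∷ r) + ascentBit u v
ascentsR _ = 0

-- IsAscentR r: reverse r is an ascent sequence, read as a growth rule on
-- the most recent entry v ≤ 1 + (ascents so far).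
IsAscentR : List ℕ → Set
IsAscentR []          = ⊥
IsAscentR (v ∷ [])    = v ≡ 0
IsAscentR (v ∷ u ∷ r) = IsAscentR (u ∷ r) × v ≤ suc (ascentsR (u ∷ r))

latest : List ℕ → ℕ
latest []      = 0
latest (v ∷ _) = v

ascentBit-< : ∀ {u v} → u < v → ascentBit u v ≡ 1
ascentBit-< {u} {v} u<v with u <ᵇ v | <⇒<ᵇ u<v
... | true | _ = refl

ascentBit-≥ : ∀ {u v} → v ≤ u → ascentBit u v ≡ 0
ascentBit-≥ {u} {v} v≤u with u <ᵇ v | <ᵇ⇒< u v
... | true  | u<v = ⊥-elim (<⇒≱ (u<v tt) v≤u)
... | false | _   = refl

ascents-grow : ∀ v r → ascentsR r ≤ ascentsR (v ∷ r)
ascents-grow v []      = z≤n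
ascents-grow v (u ∷ r) = m≤m+n _ _

ascents-up : ∀ {v u} r → u < v → ascentsR (v ∷ u ∷ r) ≡ suc (ascentsR (u ∷ r))
ascents-up r u<v = trans (cong (ascentsR (_ ∷ r) +_) (ascentBit-< u<v)) (+-comm _ 1)

ascents-flat : ∀ {v u} r → v ≤ u → ascentsR (v ∷ u ∷ r) ≡ ascentsR (u ∷ r)
ascents-flat r v≤u = trans (cong (ascentsR (_ ∷ r) +_) (ascentBit-≥ v≤u)) (+-identityʳ _)

reverse-∷∷ : ∀ (v u : ℕ) r → reverse (v ∷ u ∷ r) ≡ (reverse r ∷ʳ u) ∷ʳ v
reverse-∷∷ v u r = trans (unfold-reverse v (u ∷ r)) (cong (_∷ʳ v) (unfold-reverse u r))

asc-∷ʳ : ∀ x u v → asc ((x ∷ʳ u) ∷ʳ v) ≡ asc (x ∷ʳ u) + ascentBit u v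
asc-∷ʳ []          u v = +-identityʳ (ascentBit u v)
asc-∷ʳ (a ∷ [])    u v = trans (cong (ascentBit a u +_) (+-identityʳ (ascentBit u v)))
                                 (cong (_+ ascentBit u v) (sym (+-identityʳ (ascentBit a u))))
asc-∷ʳ (a ∷ b ∷ x) u v = trans (cong (ascentBit a b +_) (asc-∷ʳ (b ∷ x) u v))
                                 (sym (+-assoc (ascentBit a b) (asc ((b ∷ x) ∷ʳ u)) (ascentBit u v)))

asc-reverse : ∀ r → asc (reverse r) ≡ ascentsR r
asc-reverse []          = refl
asc-reverse (v ∷ [])    = refl
asc-reverse (v ∷ u ∷ r) = begin
  asc (reverse (v ∷ u ∷ r))                 ≡⟨ cong asc (reverse-∷∷ v u r) ⟩
  asc ((reverse r ∷ʳ u) ∷ʳ v)               ≡⟨ asc-∷ʳ (reverse r) u v ⟩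
  asc (reverse r ∷ʳ u) + ascentBit u v      ≡⟨ cong (λ y → asc y + ascentBit u v) (unfold-reverse u r) ⟨
  asc (reverse (u ∷ r)) + ascentBit u v     ≡⟨ cong (_+ ascentBit u v) (asc-reverse (u ∷ r)) ⟩
  ascentsR (u ∷ r) + ascentBit u v          ∎
  where open ≡-Reasoning

StartsWithZero : List ℕ → Set
StartsWithZero x = ∃ λ r → x ≡ 0 ∷ r

startsWithZero-head : ∀ h t t′ → StartsWithZero (h ∷ t) → StartsWithZero (h ∷ t′)
startsWithZero-head h t t′ (_ , e) = t′ , cong (_∷ t′) (∷-injectiveˡ e)

startsWithZero-∷ʳ : ∀ z u v → StartsWithZero ((z ∷ʳ u) ∷ʳ v) ⇔ StartsWithZero (z ∷ʳ u)
startsWithZero-∷ʳ []      u v = mk⇔ (startsWithZero-head u _ _) (startsWithZero-head u _ _)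
startsWithZero-∷ʳ (h ∷ z) u v = mk⇔ (startsWithZero-head h _ _) (startsWithZero-head h _ _)

-- Bounded acc x: each entry of x is at most one more than the number of
-- ascents of acc followed by the entries of x before it.  By definition
-- IsAscent x = StartsWithZero x × Bounded [] x.
Bounded : List ℕ → List ℕ → Set
Bounded acc x = (i : Fin (length x)) → lookup x i ≤ suc (asc (acc ++ take (toℕ i) x))

bounded-∷ : ∀ acc a y → Bounded acc (a ∷ y) ⇔ (a ≤ suc (asc acc) × Bounded (acc ∷ʳ a) y)
bounded-∷ acc a y = mk⇔ split join
  where
  shift : ∀ i → (acc ∷ʳ a) ++ take (toℕ i) y ≡ acc ++ take (toℕ (Fin.suc i)) (a ∷ y)
  shift i = ++-assoc acc (a ∷ []) (take (toℕ i) y)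

  split : Bounded acc (a ∷ y) → a ≤ suc (asc acc) × Bounded (acc ∷ʳ a) y
  split b = subst (λ t → a ≤ suc (asc t)) (++-identityʳ acc) (b Fin.zero)
          , λ i → subst (λ t → lookup y i ≤ suc (asc t)) (sym (shift i)) (b (Fin.suc i))

  join : a ≤ suc (asc acc) × Bounded (acc ∷ʳ a) y → Bounded acc (a ∷ y)
  join (a≤ , b) Fin.zero    = subst (λ t → a ≤ suc (asc t)) (sym (++-identityʳ acc)) a≤
  join (a≤ , b) (Fin.suc i) = subst (λ t → lookup y i ≤ suc (asc t)) (shift i) (b i)

-- Bounded is a condition on each entry separately, so it splits off the last entry.
bounded-∷ʳ : ∀ acc x v → Bounded acc (x ∷ʳ v) ⇔ (Bounded acc x × v ≤ suc (asc (acc ++ x)))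
bounded-∷ʳ acc []      v = mk⇔ (λ b → (λ ()) , b Fin.zero) (λ { (_ , v≤) Fin.zero → v≤ })
bounded-∷ʳ acc (a ∷ y) v = mk⇔ split join
  where
  IH : Bounded (acc ∷ʳ a) (y ∷ʳ v) ⇔ (Bounded (acc ∷ʳ a) y × v ≤ suc (asc ((acc ∷ʳ a) ++ y)))
  IH = bounded-∷ʳ (acc ∷ʳ a) y v
  reassoc : (acc ∷ʳ a) ++ y ≡ acc ++ a ∷ y
  reassoc = ++-assoc acc (a ∷ []) y

  split : Bounded acc (a ∷ y ∷ʳ v) → Bounded acc (a ∷ y) × v ≤ suc (asc (acc ++ a ∷ y))
  split b =
    let (a≤ , b′) = to (bounded-∷ acc a (y ∷ʳ v)) b
        (by , v≤) = to IH b′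
    in from (bounded-∷ acc a y) (a≤ , by) , subst (λ t → v ≤ suc (asc t)) reassoc v≤

  join : Bounded acc (a ∷ y) × v ≤ suc (asc (acc ++ a ∷ y)) → Bounded acc (a ∷ y ∷ʳ v)
  join (b , v≤) =
    let (a≤ , by) = to (bounded-∷ acc a y) b
    in from (bounded-∷ acc a (y ∷ʳ v))
        (a≤ , from IH (by , subst (λ t → v ≤ suc (asc t)) (sym reassoc) v≤))

isAscent-reverse : ∀ r → IsAscent (reverse r) ⇔ IsAscentR r
isAscent-reverse []          = mk⇔ (λ { ((_ , ()) , _) }) (λ ())
isAscent-reverse (v ∷ [])    = mk⇔ (λ ((_ , e) , _) → ∷-injectiveˡ e)
                                   (λ { refl → ([] , refl) , λ { Fin.zero → z≤n } })
isAscent-reverse (v ∷ u ∷ r) = extend (isAscent-reverse (u ∷ r))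
  where
  y : List ℕ
  y = reverse r ∷ʳ u
  y≡ : y ≡ reverse (u ∷ r)
  y≡ = sym (unfold-reverse u r)
  ascents-y : asc y ≡ ascentsR (u ∷ r)
  ascents-y = trans (cong asc y≡) (asc-reverse (u ∷ r))

  extend : IsAscent (reverse (u ∷ r)) ⇔ IsAscentR (u ∷ r) →
           IsAscent (reverse (v ∷ u ∷ r)) ⇔ IsAscentR (v ∷ u ∷ r)
  extend IH = mk⇔ split join
    where
    split : IsAscent (reverse (v ∷ u ∷ r)) → IsAscentR (v ∷ u ∷ r)
    split isa =
      let (z , b)   = subst IsAscent (reverse-∷∷ v u r) isa
          (by , v≤) = to (bounded-∷ʳ [] y v) b
      in to IH (subst IsAscent y≡ (to (startsWithZero-∷ʳ (reverse r) u v) z , by))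
      , subst (λ n → v ≤ suc n) ascents-y v≤

    join : IsAscentR (v ∷ u ∷ r) → IsAscent (reverse (v ∷ u ∷ r))
    join (isa , v≤) =
      let (z , by) = subst IsAscent (sym y≡) (from IH isa)
      in subst IsAscent (sym (reverse-∷∷ v u r))
          ( from (startsWithZero-∷ʳ (reverse r) u v) z
          , from (bounded-∷ʳ [] y v) (by , subst (λ n → v ≤ suc n) (sym ascents-y) v≤))

Increasing : ∀ {k n} → (Fin k → Fin n) → Set
Increasing {k} f = (i j : Fin k) → i Fin.< j → f i Fin.< f j

Positions : (ℕ → ℕ) → List ℕ → List ℕ → Set
Positions h p x = Σ (Fin (length p) → Fin (length x)) λ f →
                    Increasing f × (∀ i → lookup x (f i) ≡ h (lookup p i))

positions-∷ : ∀ {h q p x} → Positions h p x → Positions h (q ∷ p) (h q ∷ x)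
positions-∷ {h} {q} {p} {x} (f , inc , val) = g , g-inc , g-val
  where
  g : Fin (suc (length p)) → Fin (suc (length x))
  g Fin.zero    = Fin.zero
  g (Fin.suc i) = Fin.suc (f i)

  g-inc : Increasing g
  g-inc Fin.zero    (Fin.suc j) _         = s≤s z≤n
  g-inc (Fin.suc i) (Fin.suc j) (s≤s i<j) = s≤s (inc i j i<j)

  g-val : ∀ i → lookup (h q ∷ x) (g i) ≡ h (lookup (q ∷ p) i)
  g-val Fin.zero    = refl
  g-val (Fin.suc i) = val i

sublist⇒positions : ∀ h p {x} → map h p ⊆ x → Positions h p x
sublist⇒positions h []      _           = (λ ()) , (λ ()) , (λ ())
sublist⇒positions h (q ∷ p) (skip y s)  =
  let (f , inc , val) = sublist⇒positions h (q ∷ p) s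
  in (Fin.suc ∘ f) , (λ i j i<j → s≤s (inc i j i<j)) , val
sublist⇒positions h (q ∷ p) (refl ∷ s) = positions-∷ {h} {q} {p} (sublist⇒positions h p s)

unsuc : ∀ {n} (j : Fin (suc n)) → 0 < toℕ j → Fin n
unsuc (Fin.suc j) _ = j

lookup-unsuc : ∀ (y : ℕ) x (j : Fin (suc (length x))) (pos : 0 < toℕ j) →
               lookup (y ∷ x) j ≡ lookup x (unsuc j pos)
lookup-unsuc y x (Fin.suc j) _ = refl

unsuc-mono : ∀ {n} (i j : Fin (suc n)) pi pj → toℕ i < toℕ j → toℕ (unsuc i pi) < toℕ (unsuc j pj)
unsuc-mono (Fin.suc i) (Fin.suc j) _ _ (s≤s i<j) = i<j

positions⇒sublist : ∀ x {k} (f : Fin k → Fin (length x)) → Increasing f →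
                    tabulate (lookup x ∘ f) ⊆ x
positions⇒sublist x       {zero}  f inc = minimum x
positions⇒sublist []      {suc k} f inc with () ← f Fin.zero
positions⇒sublist (y ∷ x) {suc k} f inc = go (f Fin.zero) refl
  where
  later-pos : (i : Fin k) → 0 < toℕ (f (Fin.suc i))
  later-pos i = ≤-trans (s≤s z≤n) (inc Fin.zero (Fin.suc i) (s≤s z≤n))

  restrict : ∀ {m} (h : Fin m → Fin (suc (length x))) (pos : ∀ i → 0 < toℕ (h i)) → Increasing h →
             tabulate (lookup (y ∷ x) ∘ h) ⊆ x
  restrict h pos inc-h =
    subst (_⊆ x) (tabulate-cong (λ i → sym (lookup-unsuc y x (h i) (pos i))))
      (positions⇒sublist x (λ i → unsuc (h i) (pos i))
        (λ i j i<j → unsuc-mono (h i) (h j) (pos i) (pos j) (inc-h i j i<j)))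

  go : (j : Fin (suc (length x))) → f Fin.zero ≡ j → tabulate (lookup (y ∷ x) ∘ f) ⊆ y ∷ x
  go Fin.zero    f0≡ = subst (λ z → lookup (y ∷ x) z ∷ tabulate (lookup (y ∷ x) ∘ f ∘ Fin.suc) ⊆ y ∷ x)
                               (sym f0≡)
                         (refl ∷ restrict (f ∘ Fin.suc) later-pos (λ i j i<j → inc _ _ (s≤s i<j)))
  go (Fin.suc _) f0≡ = skip y (restrict f pos inc)
    where
    pos : ∀ i → 0 < toℕ (f i)
    pos Fin.zero    = subst (λ z → 0 < toℕ z) (sym f0≡) (s≤s z≤n)
    pos (Fin.suc i) = later-pos i

uncons : ∀ {c v : ℕ} {w r} → c ∷ w ⊆ v ∷ r → (c ≡ v × w ⊆ r) ⊎ (c ∷ w ⊆ r)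
uncons (skip _ s) = inj₂ s
uncons (refl ∷ s) = inj₁ (refl , s)

no-pair-in-single : ∀ {x y z : ℕ} {w} → ¬ (x ∷ y ∷ w ⊆ z ∷ [])
no-pair-in-single (skip _ ())
no-pair-in-single (_ ∷ ())

StrictlyMonotone : (ℕ → ℕ) → Set
StrictlyMonotone h = ∀ {m n} → m < n → h m < h n

reflect-< : ∀ {h} → StrictlyMonotone h → ∀ {m n} → h m < h n → m < n
reflect-< {h} mono {m} {n} hm<hn with <-cmp m n
... | tri< m<n _ _ = m<n
... | tri≈ _ refl _ = ⊥-elim (<-irrefl refl hm<hn)
... | tri> _ _ n<m = ⊥-elim (<-asym hm<hn (mono n<m))

reflect-≡ : ∀ {h} → StrictlyMonotone h → ∀ {m n} → h m ≡ h n → m ≡ n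
reflect-≡ {h} mono {m} {n} hm≡hn with <-cmp m n
... | tri< m<n _ _ = ⊥-elim (<-irrefl hm≡hn (mono m<n))
... | tri≈ _ m≡n _ = m≡n
... | tri> _ _ n<m = ⊥-elim (<-irrefl (sym hm≡hn) (mono n<m))

occurs-image : ∀ {h} → StrictlyMonotone h → ∀ p x → map h p ⊆ x → Occurs p x
occurs-image {h} mono p x s =
  let (f , inc , val′) = sublist⇒positions h p s
  in f , inc , λ i j →
       mk⇔ (λ lt → reflect-< mono (subst₂ _<_ (val′ i) (val′ j) lt))
           (λ lt → subst₂ _<_ (sym (val′ i)) (sym (val′ j)) (mono lt))
     , mk⇔ (λ eq → reflect-≡ mono (trans (sym (val′ i)) (trans eq (val′ j))))
           (λ eq → trans (val′ i) (trans (cong h eq) (sym (val′ j))))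

relabel : ℕ → ℕ → ℕ → ℕ → ℕ
relabel a b c zero          = a
relabel a b c (suc zero)    = b
relabel a b c (suc (suc n)) = n + c

relabel-mono : ∀ {a b c} → a < b → b < c → StrictlyMonotone (relabel a b c)
relabel-mono a<b b<c {zero}        {suc zero}    _               = a<b
relabel-mono a<b b<c {zero}        {suc (suc n)} _               = <-≤-trans (<-trans a<b b<c) (m≤n+m _ n)
relabel-mono a<b b<c {suc zero}    {suc (suc n)} _               = <-≤-trans b<c (m≤n+m _ n)
relabel-mono a<b b<c {suc (suc m)} {suc (suc n)} (s≤s (s≤s m<n)) = +-monoˡ-< _ m<n
relabel-mono a<b b<c {suc zero}    {suc zero}    (s≤s ())

-- A shape arranges three values a < b < c into a list.
Shape : Set
Shape = ℕ → ℕ → ℕ → List ℕ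

Contains : Shape → List ℕ → Set
Contains shape x = Σ ℕ λ a → Σ ℕ λ b → Σ ℕ λ c → a < b × b < c × shape a b c ⊆ x

contains-skip : ∀ {shape v r} → Contains shape r → Contains shape (v ∷ r)
contains-skip (a , b , c , a<b , b<c , s) = a , b , c , a<b , b<c , skip _ s

shape102 shape0102 shape0112 : Shape
shape102  a b c = b ∷ a ∷ c ∷ []
shape0102 a b c = a ∷ b ∷ a ∷ c ∷ []
shape0112 a b c = a ∷ b ∷ b ∷ c ∷ []

contains⇒occurs : ∀ p x → Contains (λ a b c → map (relabel a b c) p) x → Occurs p x
contains⇒occurs p x (a , b , c , a<b , b<c , s) = occurs-image (relabel-mono a<b b<c) p x s

-- Conversely, the values of an occurrence of p give a < b < c with x containing them in the
-- arrangement of p; for 0102 and 0112 the repeated letter is read off from the equalities.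
occurs102⇔ : ∀ x → Occurs p102 x ⇔ Contains shape102 x
occurs102⇔ x = mk⇔ values (contains⇒occurs p102 x)
  where
  values : Occurs p102 x → Contains shape102 x
  values (f , inc , iso) =
      lookup x (f (# 1)) , lookup x (f (# 0)) , lookup x (f (# 2))
    , from (proj₁ (iso (# 1) (# 0))) (s≤s z≤n) , from (proj₁ (iso (# 0) (# 2))) (s≤s (s≤s z≤n))
    , positions⇒sublist x f inc

occurs0102⇔ : ∀ x → Occurs p0102 x ⇔ Contains shape0102 x
occurs0102⇔ x = mk⇔ values (contains⇒occurs p0102 x)
  where
  values : Occurs p0102 x → Contains shape0102 x
  values (f , inc , iso) =
      a , lookup x (f (# 1)) , lookup x (f (# 3))
    , from (proj₁ (iso (# 0) (# 1))) (s≤s z≤n) , from (proj₁ (iso (# 1) (# 3))) (s≤s (s≤s z≤n))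
    , subst (λ z → a ∷ lookup x (f (# 1)) ∷ z ∷ lookup x (f (# 3)) ∷ [] ⊆ x)
            (from (proj₂ (iso (# 2) (# 0))) refl) (positions⇒sublist x f inc)
    where
    a : ℕ
    a = lookup x (f (# 0))

occurs0112⇔ : ∀ x → Occurs p0112 x ⇔ Contains shape0112 x
occurs0112⇔ x = mk⇔ values (contains⇒occurs p0112 x)
  where
  values : Occurs p0112 x → Contains shape0112 x
  values (f , inc , iso) =
      lookup x (f (# 0)) , b , lookup x (f (# 3))
    , from (proj₁ (iso (# 0) (# 1))) (s≤s z≤n) , from (proj₁ (iso (# 1) (# 3))) (s≤s (s≤s z≤n))
    , subst (λ z → lookup x (f (# 0)) ∷ b ∷ z ∷ lookup x (f (# 3)) ∷ [] ⊆ x)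
            (from (proj₂ (iso (# 2) (# 1))) refl) (positions⇒sublist x f inc)
    where
    b : ℕ
    b = lookup x (f (# 1))

mirror : Shape → Shape
mirror shape a b c = reverse (shape a b c)

contains-reverse : ∀ shape r → Contains shape (reverse r) ⇔ Contains (mirror shape) r
contains-reverse shape r = mk⇔
  (λ (a , b , c , a<b , b<c , s) →
     a , b , c , a<b , b<c , subst (reverse (shape a b c) ⊆_) (reverse-involutive r) (reverse⁺ s))
  (λ (a , b , c , a<b , b<c , s) →
     a , b , c , a<b , b<c , subst (_⊆ reverse r) (reverse-involutive (shape a b c)) (reverse⁺ s))

avoids-reverse : ∀ {p shape} → (∀ x → Occurs p x ⇔ Contains shape x) →
                 ∀ r → Avoids p (reverse r) ⇔ (¬ Contains (mirror shape) r)
avoids-reverse {p} {shape} occurs⇔ r = mk⇔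
  (λ av c → av (from (occurs⇔ (reverse r)) (from (contains-reverse shape r) c)))
  (λ av o → av (to (contains-reverse shape r) (to (occurs⇔ (reverse r)) o)))

hasCount-reverse : ∀ {P} (L : List (List ℕ)) → Unique L → (∀ r → r ∈ L ⇔ P (reverse r)) →
                   HasCount P (length L)
hasCount-reverse {P} L uniq mem =
    map reverse L , Unique.map⁺ reverse-injective uniq
  , (λ x → mk⇔ (listed⇒P x) (P⇒listed x)) , length-map reverse L
  where
  listed⇒P : ∀ x → x ∈ map reverse L → P x
  listed⇒P x x∈ = let (r , r∈ , eq) = ∈-map⁻ reverse x∈ in subst P (sym eq) (to (mem r) r∈)

  P⇒listed : ∀ x → P x → x ∈ map reverse L
  P⇒listed x px = subst (_∈ map reverse L) (reverse-involutive x)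
    (∈-map⁺ reverse (from (mem (reverse x)) (subst P (sym (reverse-involutive x)) px)))

hasCount-cong : ∀ {P Q m} → (∀ x → P x ⇔ Q x) → HasCount P m → HasCount Q m
hasCount-cong P⇔Q (L , uniq , mem , len) =
  L , uniq , (λ x → mk⇔ (to (P⇔Q x) ∘ to (mem x)) (from (mem x) ∘ from (P⇔Q x))) , len

-- A label (k , o): k is the number of "low" children, o records whether the node is
-- still on the open branch where k grows with each up-step.
Label : Set
Label = ℕ × Bool

raise : Bool → ℕ → ℕ
raise true  k = suc k
raise false k = k

-- The succession rule, shared by 102- and 0112-avoiders: (k , o) has the children
-- (raise o k , o), (k , o) and (u , false) for every u < k.
childLabels : Label → List Label
childLabels (k , o) = (raise o k , o) ∷ (k , o) ∷ map (λ u → u , false) (downFrom k)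

labelLevel : ℕ → List Label
labelLevel zero    = (0 , true) ∷ []
labelLevel (suc n) = concatMap childLabels (labelLevel n)

-- A class of reversed ascent sequences closed under removing the most recent entry and
-- generated by the succession rule: an invariant Inv attaches labels to sequences, the
-- children of r with label (k , o) are r extended by suc k, by stay k and by drop u for
-- u < k, and these letters are pairwise distinct and exhaust the admissible next entries.
-- Then the tree enumerates the class without repetitions, level by level, and its shape
-- (hence the size of each level) depends only on the succession rule.
module GeneratingTree
  (Avoid      : List ℕ → Set)
  (avoid-tail : ∀ {v r} → Avoid (v ∷ r) → Avoid r)
  (Inv        : List ℕ → Label → Set)
  (stay drop  : ℕ → ℕ)
  (letters-unique : ∀ k → Unique (suc k ∷ stay k ∷ map drop (downFrom k)))
  (inv-root   : Inv (0 ∷ []) (0 , true))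
  (inv-avoid  : ∀ {r l} → Inv r l → IsAscentR r × Avoid r)
  (inv-up     : ∀ {r k o} → Inv r (k , o) → Inv (suc k ∷ r) (raise o k , o))
  (inv-stay   : ∀ {r k o} → Inv r (k , o) → Inv (stay k ∷ r) (k , o))
  (inv-drop   : ∀ {r k o u} → Inv r (k , o) → u < k → Inv (drop u ∷ r) (u , false))
  (next-letter : ∀ {r k o v} → Inv r (k , o) → IsAscentR (v ∷ r) × Avoid (v ∷ r) →
                 v ∈ suc k ∷ stay k ∷ map drop (downFrom k))
  where

  Good : List ℕ → Set
  Good r = IsAscentR r × Avoid r

  good-tail : ∀ {v u r} → Good (v ∷ u ∷ r) → Good (u ∷ r)
  good-tail ((asc , _) , av) = asc , avoid-tail av

  letters : ℕ → List ℕ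
  letters k = suc k ∷ stay k ∷ map drop (downFrom k)

  Node : Set
  Node = List ℕ × Label

  children : Node → List Node
  children (r , (k , o)) = (suc k ∷ r , (raise o k , o)) ∷ (stay k ∷ r , (k , o))
                         ∷ map (λ u → drop u ∷ r , (u , false)) (downFrom k)

  level : ℕ → List Node
  level zero    = (0 ∷ [] , (0 , true)) ∷ []
  level (suc n) = concatMap children (level n)

  children-labels : ∀ e → map proj₂ (children e) ≡ childLabels (proj₂ e)
  children-labels (r , (k , o)) = cong (λ t → _ ∷ _ ∷ t) (sym (map-∘ (downFrom k)))

  children-sequences : ∀ r k o → map proj₁ (children (r , (k , o))) ≡ map (_∷ r) (letters k)
  children-sequences r k o =
    cong (λ t → _ ∷ _ ∷ t) (trans (sym (map-∘ (downFrom k))) (map-∘ (downFrom k)))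

  child-of-letter : ∀ r k o {v} → v ∈ letters k → ∃ λ c → c ∈ children (r , (k , o)) × v ∷ r ≡ proj₁ c
  child-of-letter r k o {v} v∈ =
    ∈-map⁻ proj₁ (subst (v ∷ r ∈_) (sym (children-sequences r k o)) (∈-map⁺ (_∷ r) v∈))

  labels-level : ∀ n → map proj₂ (level n) ≡ labelLevel n
  labels-level zero    = refl
  labels-level (suc n) = begin
    map proj₂ (concatMap children (level n))            ≡⟨ map-concatMap proj₂ children (level n) ⟩
    concatMap (map proj₂ ∘ children) (level n)          ≡⟨ concatMap-cong children-labels (level n) ⟩
    concatMap (childLabels ∘ proj₂) (level n)           ≡⟨ concatMap-map childLabels proj₂ (level n) ⟨
    concatMap childLabels (map proj₂ (level n))         ≡⟨ cong (concatMap childLabels) (labels-level n) ⟩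
    concatMap childLabels (labelLevel n)                ∎
    where open ≡-Reasoning

  child-extends : ∀ e {c} → c ∈ children e → ∃ λ v → proj₁ c ≡ v ∷ proj₁ e
  child-extends (r , (k , o)) (here refl)         = _ , refl
  child-extends (r , (k , o)) (there (here refl)) = _ , refl
  child-extends (r , (k , o)) (there (there c∈)) with _ , _ , refl ← ∈-map⁻ _ c∈ = _ , refl

  child-invariant : ∀ r k o {c} → Inv r (k , o) → c ∈ children (r , (k , o)) → Inv (proj₁ c) (proj₂ c)
  child-invariant r k o inv (here refl)         = inv-up inv
  child-invariant r k o inv (there (here refl)) = inv-stay inv
  child-invariant r k o inv (there (there c∈)) with u , u∈ , refl ← ∈-map⁻ _ c∈ =
    inv-drop inv (∈-downFrom⁻ u∈)

  level-sound : ∀ n {e} → e ∈ level n → Inv (proj₁ e) (proj₂ e) × length (proj₁ e) ≡ suc n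
  level-sound zero    (here refl) = inv-root , refl
  level-sound (suc n) e∈ with parent , parent∈ , e∈children ← find (∈-concatMap⁻ children e∈) =
    let (inv , len) = level-sound n parent∈
        (_ , ext)   = child-extends parent e∈children
    in child-invariant _ _ _ inv e∈children , trans (cong length ext) (cong suc len)

  level-complete : ∀ n r → Good r → length r ≡ suc n → ∃ λ l → (r , l) ∈ level n
  level-complete zero    (v ∷ [])     (refl , _) refl = _ , here refl
  level-complete (suc n) (v ∷ u ∷ r)  good       len
    with (k , o) , parent∈ ← level-complete n (u ∷ r) (good-tail good) (suc-injective len)
    with c , c∈ , eq ← child-of-letter (u ∷ r) k o (next-letter (proj₁ (level-sound n parent∈)) good)
    = proj₂ c , subst (λ s → (s , proj₂ c) ∈ level (suc n)) (sym eq)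
                  (∈-concatMap⁺ children (lose parent∈ c∈))

  children-unique : ∀ e → Unique (map proj₁ (children e))
  children-unique (r , (k , o)) =
    subst Unique (sym (children-sequences r k o)) (Unique.map⁺ ∷-injectiveˡ (letters-unique k))

  -- Uniqueness: distinct parents have distinct children, since a child determines its parent.
  level-unique : ∀ n → Unique (map proj₁ (level n))
  level-unique zero    = All.[] ∷ []
  level-unique (suc n) = concat-unique (level n) (level-unique n)
    where
    concat-unique : ∀ L → Unique (map proj₁ L) → Unique (map proj₁ (concatMap children L))
    concat-unique []      _              = []
    concat-unique (e ∷ L) (e∉L ∷ uniqL) =
      subst Unique (sym (map-++ proj₁ (children e) (concatMap children L)))
        (Unique.++⁺ (children-unique e) (concat-unique L uniqL) disjoint)
      where
      disjoint : ∀ {s} → ¬ (s ∈ map proj₁ (children e) × s ∈ map proj₁ (concatMap children L))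
      disjoint (s∈₁ , s∈₂)
        with c₁ , c₁∈ , refl ← ∈-map⁻ proj₁ s∈₁
        with c₂ , c₂∈ , eq   ← ∈-map⁻ proj₁ s∈₂
        with e′ , e′∈ , c₂∈′ ← find (∈-concatMap⁻ children c₂∈)
        = let (_ , ext₁) = child-extends e c₁∈
              (_ , ext₂) = child-extends e′ c₂∈′
          in All.lookup e∉L (∈-map⁺ proj₁ e′∈) (∷-injectiveʳ (trans (sym ext₁) (trans eq ext₂)))

  enumeration : ℕ → List (List ℕ)
  enumeration n = map proj₁ (level n)

  ∈-enumeration : ∀ n r → r ∈ enumeration n ⇔ (Good r × length r ≡ suc n)
  ∈-enumeration n r = mk⇔
    (λ r∈ → let (e , e∈ , eq) = ∈-map⁻ proj₁ r∈
                (inv , len)   = level-sound n e∈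
            in subst (λ s → Good s × length s ≡ suc n) (sym eq) (inv-avoid inv , len))
    (λ (good , len) → let (l , r∈) = level-complete n r good len in ∈-map⁺ proj₁ r∈)

  length-enumeration : ∀ n → length (enumeration n) ≡ length (labelLevel n)
  length-enumeration n = begin
    length (map proj₁ (level n))    ≡⟨ length-map proj₁ (level n) ⟩
    length (level n)                ≡⟨ length-map proj₂ (level n) ⟨
    length (map proj₂ (level n))    ≡⟨ cong length (labels-level n) ⟩
    length (labelLevel n)           ∎
    where open ≡-Reasoning

  count : ∀ p → (∀ r → Avoids p (reverse r) ⇔ Avoid r) →
          ∀ n → HasCount (AvAsc p (suc n)) (length (labelLevel n))
  count p avoid⇔ n = subst (HasCount (AvAsc p (suc n))) (length-enumeration n)
                       (hasCount-reverse (enumeration n) (level-unique n) members)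
    where
    members : ∀ r → r ∈ enumeration n ⇔ AvAsc p (suc n) (reverse r)
    members r = mk⇔
      (λ r∈ → let ((asc , av) , len) = to (∈-enumeration n r) r∈
              in from (isAscent-reverse r) asc , trans (length-reverse r) len , from (avoid⇔ r) av)
      (λ (asc , len , av) → from (∈-enumeration n r)
              ((to (isAscent-reverse r) asc , to (avoid⇔ r) av) , trans (sym (length-reverse r)) len))

  invariant-of-good : ∀ r → Good r → ∃ λ l → Inv r l
  invariant-of-good []      (() , _)
  invariant-of-good (v ∷ r) good =
    let (l , r∈) = level-complete (length r) (v ∷ r) good refl
    in l , proj₁ (level-sound (length r) r∈)

-- Read reversed, r avoids 102 when no c ∷ a ∷ b ⊆ r with a < b < c.  A 102-avoiding
-- ascent sequence with maximum M contains every value 0 … M, every value below an entry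
-- occurs before it, and every "10" extends to "010".  On the open branch the sequence is
-- weakly increasing with M ascents; off it, after a descent to k, the admissible next
-- entries are exactly 0 … k + 1.
module Avoiding102 where

  Avoid : List ℕ → Set
  Avoid r = ¬ Contains (mirror shape102) r

  -- Descent r w: r has a "10" (b, then later a < b) with b < w; appending w would complete it to 102.
  Descent : List ℕ → ℕ → Set
  Descent r w = Σ ℕ λ a → Σ ℕ λ b → a < b × b < w × a ∷ b ∷ [] ⊆ r

  avoid-∷ : ∀ {v r} → Avoid r → ¬ Descent r v → Avoid (v ∷ r)
  avoid-∷ av no-descent (a , b , c , a<b , b<c , s) with uncons s
  ... | inj₁ (refl , s′) = no-descent (a , b , a<b , b<c , s′)
  ... | inj₂ s′          = av (a , b , c , a<b , b<c , s′)

  avoid-tail : ∀ {v r} → Avoid (v ∷ r) → Avoid r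
  avoid-tail av = av ∘ contains-skip

  avoid⇒no-descent : ∀ {v r} → Avoid (v ∷ r) → ¬ Descent r v
  avoid⇒no-descent av (a , b , a<b , b<v , s) = av (a , b , _ , a<b , b<v , refl ∷ s)

  descent-∷ : ∀ {v r w} → Descent (v ∷ r) w →
              (Σ ℕ λ b → v < b × b < w × b ∷ [] ⊆ r) ⊎ Descent r w
  descent-∷ (a , b , a<b , b<w , s) with uncons s
  ... | inj₁ (refl , s′) = inj₁ (b , a<b , b<w , s′)
  ... | inj₂ s′          = inj₂ (a , b , a<b , b<w , s′)

  descent-skip : ∀ {v r w} → Descent r w → Descent (v ∷ r) w
  descent-skip (a , b , a<b , b<w , s) = a , b , a<b , b<w , skip _ s

  record Core (r : List ℕ) (M : ℕ) : Set where
    field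
      ascent   : IsAscentR r
      avoid    : Avoid r
      bounded  : ∀ u → u ∷ [] ⊆ r → u ≤ M
      full     : ∀ u → u ≤ M → u ∷ [] ⊆ r
      M≤asc    : M ≤ ascentsR r
      earlier  : ∀ a b → a < b → b ∷ [] ⊆ r → b ∷ a ∷ [] ⊆ r
      repeated : ∀ a b → a < b → a ∷ b ∷ [] ⊆ r → a ∷ b ∷ a ∷ [] ⊆ r

  Mode : Bool → ℕ → ℕ → List ℕ → Set
  Mode true  k M r = k ≡ M × ascentsR r ≡ M × latest r ≡ M × (∀ w → ¬ Descent r w)
  Mode false k M r = k < M × (∀ w → Descent r w → suc k < w) × (∀ w → suc k < w → Descent r w)

  Inv : List ℕ → Label → Set
  Inv r (k , o) = Σ ℕ λ M → Core r M × Mode o k M r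

  core-step : ∀ {r M v} → Core r M → v ≤ M → ¬ Descent r v → Core (v ∷ r) M
  core-step {[]} core _ _ = ⊥-elim (Core.ascent core)
  core-step {u ∷ r} {M} {v} core v≤M no-descent = record
    { ascent   = ascent , ≤-trans v≤M (≤-trans M≤asc (n≤1+n _))
    ; avoid    = avoid-∷ avoid no-descent
    ; bounded  = bounded′
    ; full     = λ x x≤M → skip v (full x x≤M)
    ; M≤asc    = ≤-trans M≤asc (ascents-grow v (u ∷ r))
    ; earlier  = earlier′
    ; repeated = repeated′
    }
    where
    open Core core
    bounded′ : ∀ x → x ∷ [] ⊆ v ∷ u ∷ r → x ≤ M
    bounded′ x s with uncons s
    ... | inj₁ (refl , _) = v≤M
    ... | inj₂ s′         = bounded x s′
    earlier′ : ∀ a b → a < b → b ∷ [] ⊆ v ∷ u ∷ r → b ∷ a ∷ [] ⊆ v ∷ u ∷ r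
    earlier′ a b a<b s with uncons s
    ... | inj₁ (refl , _) = refl ∷ full a (<⇒≤ (<-≤-trans a<b v≤M))
    ... | inj₂ s′         = skip v (earlier a b a<b s′)
    repeated′ : ∀ a b → a < b → a ∷ b ∷ [] ⊆ v ∷ u ∷ r → a ∷ b ∷ a ∷ [] ⊆ v ∷ u ∷ r
    repeated′ a b a<b s with uncons s
    ... | inj₁ (refl , s′) = refl ∷ earlier a b a<b s′
    ... | inj₂ s′          = skip v (repeated a b a<b s′)

  open-ascents-up : ∀ {r M} → IsAscentR r → ascentsR r ≡ M → latest r ≡ M → ascentsR (suc M ∷ r) ≡ suc M
  open-ascents-up {u ∷ r} _ asc≡M refl = trans (ascents-up r (n<1+n _)) (cong suc asc≡M)

  open-ascents-flat : ∀ {r M} → IsAscentR r → ascentsR r ≡ M → latest r ≡ M → ascentsR (M ∷ r) ≡ M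
  open-ascents-flat {u ∷ r} _ asc≡M refl = trans (ascents-flat r ≤-refl) asc≡M

  core-new : ∀ {r M} → Core r M → ascentsR r ≡ M → latest r ≡ M → (∀ w → ¬ Descent r w) →
             Core (suc M ∷ r) (suc M)
  core-new {[]} core _ _ _ = ⊥-elim (Core.ascent core)
  core-new {.M ∷ r} {M} core asc≡M refl flat = record
    { ascent   = ascent , s≤s (≤-reflexive (sym asc≡M))
    ; avoid    = avoid-∷ avoid (flat _)
    ; bounded  = bounded′
    ; full     = full′
    ; M≤asc    = ≤-reflexive (sym (open-ascents-up ascent asc≡M refl))
    ; earlier  = earlier′
    ; repeated = repeated′
    }
    where
    open Core core
    bounded′ : ∀ x → x ∷ [] ⊆ suc M ∷ M ∷ r → x ≤ suc M
    bounded′ x s with uncons s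
    ... | inj₁ (refl , _) = ≤-refl
    ... | inj₂ s′         = m≤n⇒m≤1+n (bounded x s′)
    full′ : ∀ x → x ≤ suc M → x ∷ [] ⊆ suc M ∷ M ∷ r
    full′ x x≤ with m≤n⇒m<n∨m≡n x≤
    ... | inj₁ x<   = skip _ (full x (s≤s⁻¹ x<))
    ... | inj₂ refl = refl ∷ minimum _
    earlier′ : ∀ a b → a < b → b ∷ [] ⊆ suc M ∷ M ∷ r → b ∷ a ∷ [] ⊆ suc M ∷ M ∷ r
    earlier′ a b a<b s with uncons s
    ... | inj₁ (refl , _) = refl ∷ full a (s≤s⁻¹ a<b)
    ... | inj₂ s′         = skip _ (earlier a b a<b s′)
    repeated′ : ∀ a b → a < b → a ∷ b ∷ [] ⊆ suc M ∷ M ∷ r → a ∷ b ∷ a ∷ [] ⊆ suc M ∷ M ∷ r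
    repeated′ a b a<b s with uncons s
    ... | inj₁ (refl , s′) = ⊥-elim (<⇒≱ a<b (m≤n⇒m≤1+n (bounded b s′)))
    ... | inj₂ s′          = skip _ (repeated a b a<b s′)

  -- Above the maximum there is nothing for a descent to end below.
  no-descent-above : ∀ {r M v w} → Core r M → M ≤ v → Descent (v ∷ r) w → Descent r w
  no-descent-above core M≤v d with descent-∷ d
  ... | inj₁ (b , v<b , _ , s) = ⊥-elim (<⇒≱ (≤-<-trans M≤v v<b) (Core.bounded core b s))
  ... | inj₂ d′                = d′

  descents-after : ∀ {r v k} → (∀ w → Descent r w → suc k < w) → k ≤ v →
                   ∀ w → Descent (v ∷ r) w → suc k < w
  descents-after old k≤v w d with descent-∷ d
  ... | inj₁ (b , v<b , b<w , _) = ≤-<-trans (≤-trans (s≤s k≤v) v<b) b<w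
  ... | inj₂ d′                  = old w d′

  inv-up : ∀ {r k o} → Inv r (k , o) → Inv (suc k ∷ r) (raise o k , o)
  inv-up {r} {o = true} (M , core , refl , asc≡M , latest≡M , flat) =
      suc M , core-new core asc≡M latest≡M flat
    , refl , open-ascents-up (Core.ascent core) asc≡M latest≡M
    , refl , (λ w d → flat w (no-descent-above core (n≤1+n M) d))
  inv-up {o = false} (M , core , k<M , desc⇒ , ⇒desc) =
      M , core-step core k<M (λ d → <-irrefl refl (desc⇒ _ d))
    , k<M , descents-after desc⇒ (n≤1+n _) , (λ w lt → descent-skip (⇒desc w lt))

  inv-stay : ∀ {r k o} → Inv r (k , o) → Inv (k ∷ r) (k , o)
  inv-stay {r} {o = true} (M , core , refl , asc≡M , latest≡M , flat) =
      M , core-step core ≤-refl (flat M)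
    , refl , open-ascents-flat (Core.ascent core) asc≡M latest≡M
    , refl , (λ w d → flat w (no-descent-above core ≤-refl d))
  inv-stay {o = false} (M , core , k<M , desc⇒ , ⇒desc) =
      M , core-step core (<⇒≤ k<M) (λ d → <-asym (desc⇒ _ d) (n<1+n _))
    , k<M , descents-after desc⇒ ≤-refl , (λ w lt → descent-skip (⇒desc w lt))

  -- Appending u below the maximum closes the branch: afterwards exactly the entries ≤ u + 1 are admissible.
  inv-below : ∀ {r M u} → Core r M → u < M → ¬ Descent r u → (∀ w → Descent r w → suc u < w) →
              Inv (u ∷ r) (u , false)
  inv-below {u = u} core u<M no-descent old =
      _ , core-step core (<⇒≤ u<M) no-descent
    , u<M , descents-after old ≤-refl
    , (λ w lt → u , suc u , n<1+n u , lt , refl ∷ Core.full core (suc u) u<M)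

  inv-drop : ∀ {r k o u} → Inv r (k , o) → u < k → Inv (u ∷ r) (u , false)
  inv-drop {o = true} (M , core , refl , _ , _ , flat) u<M =
    inv-below core u<M (flat _) (λ w d → ⊥-elim (flat w d))
  inv-drop {o = false} (M , core , k<M , desc⇒ , _) u<k =
    inv-below core (<-trans u<k k<M) (λ d → <-asym (desc⇒ _ d) (m<n⇒m<1+n u<k))
      (λ w d → <-trans (s≤s u<k) (desc⇒ w d))

  next-bound : ∀ {r k o v} → Inv r (k , o) → IsAscentR (v ∷ r) × Avoid (v ∷ r) → v ≤ suc k
  next-bound {[]} (_ , core , _) _ = ⊥-elim (Core.ascent core)
  next-bound {u ∷ r} {o = true}  {v} (M , core , refl , asc≡M , _) ((_ , v≤) , _) =
    subst (λ n → v ≤ suc n) asc≡M v≤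
  next-bound {u ∷ r} {o = false} (M , core , _ , _ , ⇒desc) (_ , av) =
    ≮⇒≥ (λ lt → avoid⇒no-descent av (⇒desc _ lt))

  inv-root : Inv (0 ∷ []) (0 , true)
  inv-root = 0 , core , refl , refl , refl , λ w (_ , _ , _ , _ , s) → no-pair-in-single s
    where
    core : Core (0 ∷ []) 0
    core = record
      { ascent   = refl
      ; avoid    = λ (_ , _ , _ , _ , _ , s) → no-pair-in-single s
      ; bounded  = λ { _ (refl ∷ _) → z≤n ; _ (skip _ ()) }
      ; full     = λ { zero z≤n → refl ∷ [] }
      ; M≤asc    = z≤n
      ; earlier  = λ { a _ a<b (refl ∷ _) → ⊥-elim (<⇒≱ a<b z≤n) ; _ _ _ (skip _ ()) }
      ; repeated = λ _ _ _ s → ⊥-elim (no-pair-in-single s)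
      }

  letter-below : ∀ {k v} → v ≤ suc k → v ∈ suc k ∷ k ∷ map (λ u → u) (downFrom k)
  letter-below v≤ with m≤n⇒m<n∨m≡n v≤
  ... | inj₂ refl = here refl
  ... | inj₁ v<sk with m≤n⇒m<n∨m≡n (s≤s⁻¹ v<sk)
  ...   | inj₂ refl = there (here refl)
  ...   | inj₁ v<k  = there (there (∈-map⁺ _ (∈-downFrom⁺ v<k)))

  letters-unique : ∀ k → Unique (suc k ∷ k ∷ map (λ u → u) (downFrom k))
  letters-unique k = subst (λ t → Unique (suc k ∷ k ∷ t)) (sym (map-id (downFrom k)))
                       (Unique.downFrom⁺ (suc (suc k)))

  module Tree = GeneratingTree Avoid avoid-tail Inv (λ k → k) (λ u → u) letters-unique inv-root
    (λ (_ , core , _) → Core.ascent core , Core.avoid core) inv-up inv-stay inv-drop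
    (λ inv good → letter-below (next-bound inv good))

  descent-repeats : ∀ {r a b} → IsAscentR r → Avoid r → a < b → a ∷ b ∷ [] ⊆ r → a ∷ b ∷ a ∷ [] ⊆ r
  descent-repeats {r} asc av a<b s =
    let (_ , _ , core , _) = Tree.invariant-of-good r (asc , av)
    in Core.repeated core _ _ a<b s

-- Read reversed, r avoids 0112 when no c ∷ b ∷ b ∷ a ⊆ r with a < b < c.  In a
-- 0112-avoiding ascent sequence 0 occurs before every positive entry, and the label k
-- records that 1 … k all occur.  On the open branch k is the number of ascents and
-- no "011" has been formed; off it the admissible next entries are exactly 0 … k + 1.
-- The letters are suc k (up), 0 (stay) and suc u for u < k (drop).
module Avoiding0112 where

  Avoid : List ℕ → Set
  Avoid r = ¬ Contains (mirror shape0112) r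

  -- Pair r w: r has "011" (a, then b twice, a < b) with b < w; appending w would complete it to 0112.
  Pair : List ℕ → ℕ → Set
  Pair r w = Σ ℕ λ a → Σ ℕ λ b → a < b × b < w × b ∷ b ∷ a ∷ [] ⊆ r

  avoid-∷ : ∀ {v r} → Avoid r → ¬ Pair r v → Avoid (v ∷ r)
  avoid-∷ av no-pair (a , b , c , a<b , b<c , s) with uncons s
  ... | inj₁ (refl , s′) = no-pair (a , b , a<b , b<c , s′)
  ... | inj₂ s′          = av (a , b , c , a<b , b<c , s′)

  avoid-tail : ∀ {v r} → Avoid (v ∷ r) → Avoid r
  avoid-tail av = av ∘ contains-skip

  avoid⇒no-pair : ∀ {v r} → Avoid (v ∷ r) → ¬ Pair r v
  avoid⇒no-pair av (a , b , a<b , b<v , s) = av (a , b , _ , a<b , b<v , refl ∷ s)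

  pair-∷ : ∀ {v r w} → Pair (v ∷ r) w → (Σ ℕ λ a → a < v × v < w × v ∷ a ∷ [] ⊆ r) ⊎ Pair r w
  pair-∷ (a , b , a<b , b<w , s) with uncons s
  ... | inj₁ (refl , s′) = inj₁ (a , a<b , b<w , s′)
  ... | inj₂ s′          = inj₂ (a , b , a<b , b<w , s′)

  pair-skip : ∀ {v r w} → Pair r w → Pair (v ∷ r) w
  pair-skip (a , b , a<b , b<w , s) = a , b , a<b , b<w , skip _ s

  no-pair-below-1 : ∀ {r} → ¬ Pair r 0
  no-pair-below-1 (_ , _ , _ , () , _)

  first-of-two : ∀ {x y : ℕ} {r} → x ∷ y ∷ [] ⊆ r → x ∷ [] ⊆ r
  first-of-two s = ⊆-trans (refl ∷ minimum _) s

  latest-occurs : ∀ {r} → IsAscentR r → latest r ∷ [] ⊆ r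
  latest-occurs {u ∷ r} _ = refl ∷ minimum r

  record Core (r : List ℕ) (k : ℕ) : Set where
    field
      ascent      : IsAscentR r
      avoid       : Avoid r
      bounded     : ∀ u → u ∷ [] ⊆ r → u ≤ ascentsR r
      present     : ∀ u → 0 < u → u ≤ k → u ∷ [] ⊆ r
      zero-before : ∀ u → 0 < u → u ∷ [] ⊆ r → u ∷ 0 ∷ [] ⊆ r
      zero-occurs : 0 ∷ [] ⊆ r

  Mode : Bool → ℕ → List ℕ → Set
  Mode true  k r = k ≡ ascentsR r × (∀ w → ¬ Pair r w)
  Mode false k r = k < ascentsR r × (∀ w → Pair r w → suc k < w) × (∀ w → suc k < w → Pair r w)

  Inv : List ℕ → Label → Set
  Inv r (k , o) = Core r k × Mode o k r

  k≤ascents : ∀ {o k r} → Mode o k r → k ≤ ascentsR r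
  k≤ascents {true}  (k≡ , _) = ≤-reflexive k≡
  k≤ascents {false} (k< , _) = <⇒≤ k<

  core-step : ∀ {r k k′ v} → Core r k → v ≤ suc (ascentsR r) → ¬ Pair r v → v ≤ ascentsR (v ∷ r) →
              (∀ u → 0 < u → u ≤ k′ → u ∷ [] ⊆ v ∷ r) → Core (v ∷ r) k′
  core-step {[]} core _ _ _ _ = ⊥-elim (Core.ascent core)
  core-step {u₀ ∷ r} {v = v} core v≤ no-pair v≤asc present′ = record
    { ascent      = ascent , v≤
    ; avoid       = avoid-∷ avoid no-pair
    ; bounded     = bounded′
    ; present     = present′
    ; zero-before = zero-before′
    ; zero-occurs = skip v zero-occurs
    }
    where
    open Core core
    bounded′ : ∀ x → x ∷ [] ⊆ v ∷ u₀ ∷ r → x ≤ ascentsR (v ∷ u₀ ∷ r)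
    bounded′ x s with uncons s
    ... | inj₁ (refl , _) = v≤asc
    ... | inj₂ s′         = ≤-trans (bounded x s′) (ascents-grow v (u₀ ∷ r))
    zero-before′ : ∀ x → 0 < x → x ∷ [] ⊆ v ∷ u₀ ∷ r → x ∷ 0 ∷ [] ⊆ v ∷ u₀ ∷ r
    zero-before′ x 0<x s with uncons s
    ... | inj₁ (refl , _) = refl ∷ zero-occurs
    ... | inj₂ s′         = skip v (zero-before x 0<x s′)

  pairs-after : ∀ {r v k} → (∀ w → Pair r w → suc k < w) → suc k ≤ v →
                ∀ w → Pair (v ∷ r) w → suc k < w
  pairs-after old sk≤v w p with pair-∷ p
  ... | inj₁ (_ , _ , v<w , _) = ≤-<-trans sk≤v v<w
  ... | inj₂ p′                = old w p′

  inv-up : ∀ {r k o} → Inv r (k , o) → Inv (suc k ∷ r) (raise o k , o)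
  inv-up {[]} (core , _) = ⊥-elim (Core.ascent core)
  inv-up {u₀ ∷ r} {k} {true} (core , k≡ , flat) =
      core-step core (s≤s (≤-reflexive k≡)) (flat _) (≤-reflexive (sym asc-up)) present′
    , sym asc-up , flat′
    where
    open Core core
    asc-up : ascentsR (suc k ∷ u₀ ∷ r) ≡ suc k
    asc-up = trans (ascents-up r (s≤s (subst (u₀ ≤_) (sym k≡) (bounded u₀ (latest-occurs ascent)))))
                   (cong suc (sym k≡))
    present′ : ∀ u → 0 < u → u ≤ suc k → u ∷ [] ⊆ suc k ∷ u₀ ∷ r
    present′ u 0<u u≤ with m≤n⇒m<n∨m≡n u≤
    ... | inj₁ u<   = skip _ (present u 0<u (s≤s⁻¹ u<))
    ... | inj₂ refl = refl ∷ minimum _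
    flat′ : ∀ w → ¬ Pair (suc k ∷ u₀ ∷ r) w
    flat′ w p with pair-∷ p
    ... | inj₁ (_ , _ , _ , s) =
      <-irrefl refl (≤-trans (bounded (suc k) (first-of-two s)) (≤-reflexive (sym k≡)))
    ... | inj₂ p′              = flat w p′
  inv-up {u₀ ∷ r} {k} {false} (core , k<asc , pair⇒ , ⇒pair) =
      core-step core (≤-trans k<asc (n≤1+n _)) (λ p → <-irrefl refl (pair⇒ _ p)) grown
        (λ u 0<u u≤ → skip _ (Core.present core u 0<u u≤))
    , grown , pairs-after pair⇒ ≤-refl , (λ w lt → pair-skip (⇒pair w lt))
    where
    grown : suc k ≤ ascentsR (suc k ∷ u₀ ∷ r)
    grown = ≤-trans k<asc (ascents-grow (suc k) (u₀ ∷ r))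

  inv-stay : ∀ {r k o} → Inv r (k , o) → Inv (0 ∷ r) (k , o)
  inv-stay {[]} (core , _) = ⊥-elim (Core.ascent core)
  inv-stay {u₀ ∷ r} {k} {o} (core , mode) =
      core-step core z≤n no-pair-below-1 z≤n (λ u 0<u u≤ → skip _ (Core.present core u 0<u u≤))
    , mode′ o mode
    where
    same : ascentsR (0 ∷ u₀ ∷ r) ≡ ascentsR (u₀ ∷ r)
    same = ascents-flat r z≤n
    pair-0 : ∀ {w} → Pair (0 ∷ u₀ ∷ r) w → Pair (u₀ ∷ r) w
    pair-0 p with pair-∷ p
    ... | inj₁ (_ , () , _)
    ... | inj₂ p′ = p′
    mode′ : ∀ o → Mode o k (u₀ ∷ r) → Mode o k (0 ∷ u₀ ∷ r)
    mode′ true  (k≡ , flat)          = trans k≡ (sym same) , λ w p → flat w (pair-0 p)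
    mode′ false (k< , pair⇒ , ⇒pair) = subst (k <_) (sym same) k<
                                     , (λ w p → pair⇒ w (pair-0 p)) , (λ w lt → pair-skip (⇒pair w lt))

  inv-drop : ∀ {r k o u} → Inv r (k , o) → u < k → Inv (suc u ∷ r) (u , false)
  inv-drop {[]} (core , _) _ = ⊥-elim (Core.ascent core)
  inv-drop {u₀ ∷ r} {k} {o} {u} (core , mode) u<k =
      core-step core (≤-trans u<k (m≤n⇒m≤1+n k≤asc)) (no-pair o mode) grown
        (λ t 0<t t≤ → skip _ (Core.present core t 0<t (≤-trans t≤ (<⇒≤ u<k))))
    , grown , pairs-after (old o mode) ≤-refl
    , (λ w lt → 0 , suc u , s≤s z≤n , lt , refl ∷ Core.zero-before core (suc u) (s≤s z≤n) su-occurs)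
    where
    k≤asc : k ≤ ascentsR (u₀ ∷ r)
    k≤asc = k≤ascents mode
    grown : suc u ≤ ascentsR (suc u ∷ u₀ ∷ r)
    grown = ≤-trans u<k (≤-trans k≤asc (ascents-grow (suc u) (u₀ ∷ r)))
    su-occurs : suc u ∷ [] ⊆ u₀ ∷ r
    su-occurs = Core.present core (suc u) (s≤s z≤n) u<k
    no-pair : ∀ o → Mode o k (u₀ ∷ r) → ¬ Pair (u₀ ∷ r) (suc u)
    no-pair true  (_ , flat)      = flat _
    no-pair false (_ , pair⇒ , _) p = <-asym (pair⇒ _ p) (s≤s u<k)
    old : ∀ o → Mode o k (u₀ ∷ r) → ∀ w → Pair (u₀ ∷ r) w → suc u < w
    old true  (_ , flat)      w p = ⊥-elim (flat w p)
    old false (_ , pair⇒ , _) w p = <-trans (s≤s u<k) (pair⇒ w p)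

  next-bound : ∀ {r k o v} → Inv r (k , o) → IsAscentR (v ∷ r) × Avoid (v ∷ r) → v ≤ suc k
  next-bound {[]} (core , _) _ = ⊥-elim (Core.ascent core)
  next-bound {u₀ ∷ r} {o = true}  {v} (_ , k≡ , _) ((_ , v≤) , _) = subst (λ n → v ≤ suc n) (sym k≡) v≤
  next-bound {u₀ ∷ r} {o = false} (_ , _ , _ , ⇒pair) (_ , av) =
    ≮⇒≥ (λ lt → avoid⇒no-pair av (⇒pair _ lt))

  letter-below : ∀ {k v} → v ≤ suc k → v ∈ suc k ∷ 0 ∷ map suc (downFrom k)
  letter-below {v = zero}  _  = there (here refl)
  letter-below {v = suc w} w< with m≤n⇒m<n∨m≡n (s≤s⁻¹ w<)
  ... | inj₁ w<k  = there (there (∈-map⁺ suc (∈-downFrom⁺ w<k)))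
  ... | inj₂ refl = here refl

  letters-unique : ∀ k → Unique (suc k ∷ 0 ∷ map suc (downFrom k))
  letters-unique k =
      ((λ ()) All.∷ All.tabulate (λ x∈ eq → sk∉ x∈ eq))
    ∷ All.tabulate (λ x∈ eq → zero∉ x∈ eq)
    ∷ Unique.map⁺ suc-injective (Unique.downFrom⁺ k)
    where
    sk∉ : ∀ {x} → x ∈ map suc (downFrom k) → suc k ≢ x
    sk∉ x∈ eq with _ , u∈ , refl ← ∈-map⁻ suc x∈ = <-irrefl (suc-injective (sym eq)) (∈-downFrom⁻ u∈)
    zero∉ : ∀ {x} → x ∈ map suc (downFrom k) → 0 ≢ x
    zero∉ x∈ eq with _ , _ , refl ← ∈-map⁻ suc x∈ = 0≢1+n eq

  inv-root : Inv (0 ∷ []) (0 , true)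
  inv-root = core , refl , λ w (_ , _ , _ , _ , s) → no-pair-in-single s
    where
    core : Core (0 ∷ []) 0
    core = record
      { ascent      = refl
      ; avoid       = λ (_ , _ , _ , _ , _ , s) → no-pair-in-single s
      ; bounded     = λ { _ (refl ∷ _) → z≤n ; _ (skip _ ()) }
      ; present     = λ u 0<u u≤0 → ⊥-elim (<⇒≱ 0<u u≤0)
      ; zero-before = λ { _ 0<x (refl ∷ _) → ⊥-elim (<-irrefl refl 0<x) ; _ _ (skip _ ()) }
      ; zero-occurs = refl ∷ []
      }

  module Tree = GeneratingTree Avoid avoid-tail Inv (λ _ → 0) suc letters-unique inv-root
    (λ (core , _) → Core.ascent core , Core.avoid core) inv-up inv-stay inv-drop
    (λ inv good → letter-below (next-bound inv good))

-- Dropping the leading 0 of an occurrence of 0102 leaves an occurrence of 102.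
contains0102⇒102 : ∀ {x} → Contains shape0102 x → Contains shape102 x
contains0102⇒102 (a , b , c , a<b , b<c , s) = a , b , c , a<b , b<c , ∷ˡ⁻ s

-- Read reversed, by induction: the prefix u ∷ r avoids 102, so an occurrence of 102 in
-- v ∷ u ∷ r ends in the latest entry v; its "10" lies in the 102-avoiding prefix and
-- extends to "010" there, which together with v is an occurrence of 0102.
avoid0102⇒avoid102 : ∀ r → IsAscentR r → ¬ Contains (mirror shape0102) r → Avoiding102.Avoid r
avoid0102⇒avoid102 (v ∷ [])    _          _      (_ , _ , _ , _ , _ , s) = no-pair-in-single s
avoid0102⇒avoid102 (v ∷ u ∷ r) (asc , _) av0102 =
  extend (avoid0102⇒avoid102 (u ∷ r) asc (av0102 ∘ contains-skip))
  where
  extend : Avoiding102.Avoid (u ∷ r) → Avoiding102.Avoid (v ∷ u ∷ r)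
  extend av (a , b , c , a<b , b<c , s) with uncons s
  ... | inj₂ s′          = av (a , b , c , a<b , b<c , s′)
  ... | inj₁ (refl , s′) = av0102 (a , b , c , a<b , b<c , refl ∷ Avoiding102.descent-repeats asc av a<b s′)

by-reversal : ∀ {P : List ℕ → Set} → (∀ r → P (reverse r)) → ∀ x → P x
by-reversal {P} h x = subst P (reverse-involutive x) (h (reverse x))

avoid102⇔avoid0102 : ∀ x → IsAscent x → Avoids p102 x ⇔ Avoids p0102 x
avoid102⇔avoid0102 x isa =
  mk⇔ weaker (by-reversal {λ y → IsAscent y → Avoids p0102 y → Avoids p102 y} stronger x isa)
  where
  weaker : Avoids p102 x → Avoids p0102 x
  weaker av o = av (from (occurs102⇔ x) (contains0102⇒102 (to (occurs0102⇔ x) o)))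

  stronger : ∀ r → IsAscent (reverse r) → Avoids p0102 (reverse r) → Avoids p102 (reverse r)
  stronger r isa av = from (avoids-reverse occurs102⇔ r)
    (avoid0102⇒avoid102 r (to (isAscent-reverse r) isa) (to (avoids-reverse occurs0102⇔ r) av))

-- Both trees follow the succession rule of childLabels, so for n ≥ 1 the
-- ascent sequences of length n avoiding 102 and those avoiding 0112 are both counted by
-- the size of level n − 1; the 0102-avoiders are the 102-avoiders.
theorem2p9 : ((n : ℕ) → 1 ≤ n →
               Σ ℕ λ m → HasCount (AvAsc p102 n) m
                       × HasCount (AvAsc p0102 n) m
                       × HasCount (AvAsc p0112 n) m)
           × ((n : ℕ) → (x : List ℕ) → IsAscent x → length x ≡ n →
               (Avoids p102 x ⇔ Avoids p0102 x))
theorem2p9 = counts , λ _ x isa _ → avoid102⇔avoid0102 x isa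
  where
  same-avoiders : ∀ n x → AvAsc p102 n x ⇔ AvAsc p0102 n x
  same-avoiders n x = mk⇔ (λ (isa , len , av) → isa , len , to (avoid102⇔avoid0102 x isa) av)
                          (λ (isa , len , av) → isa , len , from (avoid102⇔avoid0102 x isa) av)

  counts : (n : ℕ) → 1 ≤ n → Σ ℕ λ m → HasCount (AvAsc p102 n) m
                                     × HasCount (AvAsc p0102 n) m
                                     × HasCount (AvAsc p0112 n) m
  counts (suc n) _ =
    let count102 = Avoiding102.Tree.count p102 (avoids-reverse occurs102⇔) n
    in length (labelLevel n)
     , count102
     , hasCount-cong (same-avoiders (suc n)) count102
     , Avoiding0112.Tree.count p0112 (avoids-reverse occurs0112⇔) n
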